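{- Let $G_0$ be a rooted $\ell$-connected directed graph with root $r$ and terminal set $T$, let $\mathcal{F}$ be the family of all deficient sets in $G_0$, and let $C$ and $C'$ be two distinct cores of $\mathcal{F}$. Then for any deficient sets $U\in\mathsf{Halo}(C)$ and $U'\in\mathsf{Halo}(C')$, it holds that $U\cap U'\cap T=\emptyset$.
   Context: $G_0$ is rooted $\ell$-connected if it contains $\ell$ edge-disjoint $r\to t$ paths for every $t\in T$ (where $T\subseteq V(G_0)\setminus\{r\}$). $\deg^{in}_{G_0}(U)$ is the number of edges of $G_0$ entering $U$. A deficient set is $U\subseteq V(G_0)$ with $r\notin U$, $U\cap T\ne\emptyset$, $\deg^{in}_{G_0}(U)=\ell$. A core is a member of $\mathcal{F}$ that properly contains no other member of $\mathcal{F}$. For a core $C$, $\mathsf{Halo}(C)$ is the collection of sets in $\mathcal{F}$ that contain $C$ and contain no core $C''\neq C$. -}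

module Defs where

open import Data.Nat using (ℕ)
open import Data.Fin using (Fin)
open import Data.Fin.Subset using (Subset; _∈_; _∉_; _⊆_; _⊂_; _∩_; Nonempty; Empty)
open import Data.Fin.Subset.Properties using (_∈?_)
open import Data.List using (List; []; _∷_; map; length; filter)
open import Data.List.Relation.Unary.Unique.Propositional using (Unique)
import Data.List.Membership.Propositional as LM
open import Data.List using () renaming (allFin to allFinL)
open import Data.Product using (Σ; ∃; _×_; _,_)
open import Data.Empty using (⊥)
open import Relation.Binary.PropositionalEquality using (_≡_)
open import Relation.Nullary using (¬_; _×-dec_; ¬?)

record Digraph : Set where
  field
    n : ℕ
    m : ℕ
    tail : Fin m → Fin n
    head : Fin m → Fin n

module _ (G : Digraph) where
  open Digraph G

  data Walk : Fin n → Fin n → List (Fin m) → Set where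
    []   : ∀ {u} → Walk u u []
    step : ∀ {u v es} (e : Fin m) → tail e ≡ u → Walk (head e) v es → Walk u v (e ∷ es)

  walkVertices : Fin n → List (Fin m) → List (Fin n)
  walkVertices u es = u ∷ map head es

  IsPath : Fin n → Fin n → List (Fin m) → Set
  IsPath u v es = Walk u v es × Unique (walkVertices u es)

  EdgeDisjointPaths : ℕ → Fin n → Fin n → Set
  EdgeDisjointPaths ℓ r t =
    Σ (Fin ℓ → List (Fin m)) λ ps →
      (∀ i → IsPath r t (ps i)) ×
      (∀ i j → ¬ (i ≡ j) → ∀ e → LM._∈_ e (ps i) → LM._∈_ e (ps j) → ⊥)

  RootedConnected : ℕ → Fin n → Subset n → Set
  RootedConnected ℓ r T = ∀ t → t ∈ T → EdgeDisjointPaths ℓ r t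

  indeg : Subset n → ℕ
  indeg U = length (filter (λ e → (head e ∈? U) ×-dec ¬? (tail e ∈? U)) (allFinL m))

  Deficient : ℕ → Fin n → Subset n → Subset n → Set
  Deficient ℓ r T U = (r ∉ U) × Nonempty (U ∩ T) × (indeg U ≡ ℓ)

  Core : ℕ → Fin n → Subset n → Subset n → Set
  Core ℓ r T C = Deficient ℓ r T C × (∀ D → Deficient ℓ r T D → ¬ (D ⊂ C))

  InHalo : ℕ → Fin n → Subset n → Subset n → Subset n → Set
  InHalo ℓ r T C U =
    Deficient ℓ r T U × (C ⊆ U) × (∀ C'' → Core ℓ r T C'' → C'' ⊆ U → C'' ≡ C)

-- Let t be a terminal in U ∩ U'. Both U ∩ U' and U ∪ U' separate t from r, so by the
-- ℓ edge-disjoint r → t paths each has in-degree at least ℓ; submodularity of the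
-- in-degree, deg(U ∩ U') + deg(U ∪ U') ≤ deg U + deg U' = 2ℓ, then forces U ∩ U' to be
-- deficient. It therefore contains a core, which lies in both halos and so equals both
-- C and C'.
module Submission where

open import Defs
open import Algebra.Properties.CommutativeSemigroup using (interchange)
open import Data.Bool using (Bool; true; false; _∧_; _∨_; not)
open import Data.Empty using (⊥-elim)
open import Data.Fin using (Fin)
open import Data.Fin.Properties using (injective⇒≤) renaming (_≟_ to _≟ᶠ_)
open import Data.Fin.Subset using (Subset; _∈_; _∉_; _⊆_; _⊂_; _∩_; _∪_; Empty)
open import Data.Fin.Subset.Induction using (⊂-wellFounded)
open import Data.Fin.Subset.Properties
  using (_∈?_; x∈p∩q⁺; x∈p∩q⁻; x∈p∪q⁺; x∈p∪q⁻; nonempty?; anySubset?; _⊂?_)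
open import Data.List using (List; []; _∷_; length; filter; lookup)
open import Data.List using () renaming (allFin to allFinL)
import Data.List.Membership.Propositional as List
open import Data.List.Membership.Propositional.Properties using (∈-filter⁺; ∈-allFin)
open import Data.List.Relation.Unary.Any using (here; there; index)
open import Data.List.Relation.Unary.Any.Properties using (lookup-index)
open import Data.Nat using (ℕ; _+_; _≤_; z≤n)
open import Data.Nat.Properties
  using (≤ᵇ⇒≤; +-mono-≤; +-monoʳ-≤; +-cancelʳ-≤; module ≤-Reasoning; ≤-antisym; +-commutativeSemigroup; _≟_)
open import Data.Product using (Σ; _×_; _,_; proj₁; proj₂)
open import Data.Sum using (inj₁; [_,_])
open import Function.Bundles using (mk⇔)
open import Induction.WellFounded using (Acc; acc)
open import Level using (0ℓ)
open import Relation.Binary.PropositionalEquality using (_≡_; refl; sym; trans; cong; cong₂; subst)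
open import Relation.Nullary using (¬_; yes; no; does; _×-dec_; _⊎-dec_; ¬?)
open import Relation.Nullary.Decidable using (does-⇔; decidable-stable)
open import Relation.Unary using (Pred; Decidable)

bit : Bool → ℕ
bit true  = 1
bit false = 0

module _ {A : Set} where

  count : {P : Pred A 0ℓ} → Decidable P → List A → ℕ
  count P? xs = length (filter P? xs)

  count-∷ : {P : Pred A 0ℓ} (P? : Decidable P) (x : A) (xs : List A) →
    count P? (x ∷ xs) ≡ bit (does (P? x)) + count P? xs
  count-∷ P? x xs with does (P? x)
  ... | true  = refl
  ... | false = refl

  count₂-mono : {P Q R S : Pred A 0ℓ}
    (P? : Decidable P) (Q? : Decidable Q) (R? : Decidable R) (S? : Decidable S) →
    (∀ x → bit (does (P? x)) + bit (does (Q? x)) ≤ bit (does (R? x)) + bit (does (S? x))) →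
    ∀ xs → count P? xs + count Q? xs ≤ count R? xs + count S? xs
  count₂-mono P? Q? R? S? pointwise [] = z≤n
  count₂-mono P? Q? R? S? pointwise (x ∷ xs)
    rewrite count-∷ P? x xs | count-∷ Q? x xs | count-∷ R? x xs | count-∷ S? x xs
          | interchange +-commutativeSemigroup (bit (does (P? x))) (count P? xs) (bit (does (Q? x))) (count Q? xs)
          | interchange +-commutativeSemigroup (bit (does (R? x))) (count R? xs) (bit (does (S? x))) (count S? xs)
    = +-mono-≤ (pointwise x) (count₂-mono P? Q? R? S? pointwise xs)

-- a, b say whether the head of an edge lies in A, B; a', b' the same for its tail.
enters-∩-∪-submodular : ∀ a b a' b' →
  bit ((a ∧ b) ∧ not (a' ∧ b')) + bit ((a ∨ b) ∧ not (a' ∨ b')) ≤ bit (a ∧ not a') + bit (b ∧ not b')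
enters-∩-∪-submodular true  true  true  true  = ≤ᵇ⇒≤ _ _ _
enters-∩-∪-submodular true  true  true  false = ≤ᵇ⇒≤ _ _ _
enters-∩-∪-submodular true  true  false true  = ≤ᵇ⇒≤ _ _ _
enters-∩-∪-submodular true  true  false false = ≤ᵇ⇒≤ _ _ _
enters-∩-∪-submodular true  false true  true  = ≤ᵇ⇒≤ _ _ _
enters-∩-∪-submodular true  false true  false = ≤ᵇ⇒≤ _ _ _
enters-∩-∪-submodular true  false false true  = ≤ᵇ⇒≤ _ _ _
enters-∩-∪-submodular true  false false false = ≤ᵇ⇒≤ _ _ _
enters-∩-∪-submodular false true  true  true  = ≤ᵇ⇒≤ _ _ _
enters-∩-∪-submodular false true  true  false = ≤ᵇ⇒≤ _ _ _
enters-∩-∪-submodular false true  false true  = ≤ᵇ⇒≤ _ _ _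
enters-∩-∪-submodular false true  false false = ≤ᵇ⇒≤ _ _ _
enters-∩-∪-submodular false false true  true  = ≤ᵇ⇒≤ _ _ _
enters-∩-∪-submodular false false true  false = ≤ᵇ⇒≤ _ _ _
enters-∩-∪-submodular false false false true  = ≤ᵇ⇒≤ _ _ _
enters-∩-∪-submodular false false false false = ≤ᵇ⇒≤ _ _ _

module _ {n : ℕ} where

  does-∈?-∩ : (x : Fin n) (p q : Subset n) → does (x ∈? p ∩ q) ≡ does (x ∈? p) ∧ does (x ∈? q)
  does-∈?-∩ x p q = does-⇔ (mk⇔ (x∈p∩q⁻ p q) x∈p∩q⁺) (x ∈? p ∩ q) ((x ∈? p) ×-dec (x ∈? q))

  does-∈?-∪ : (x : Fin n) (p q : Subset n) → does (x ∈? p ∪ q) ≡ does (x ∈? p) ∨ does (x ∈? q)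
  does-∈?-∪ x p q = does-⇔ (mk⇔ (x∈p∪q⁻ p q) x∈p∪q⁺) (x ∈? p ∪ q) ((x ∈? p) ⊎-dec (x ∈? q))

  ⊂-minimal-⊆ : {P : Pred (Subset n) 0ℓ} → Decidable P → ∀ D → P D →
    Σ (Subset n) λ C → (P C × (∀ D' → P D' → ¬ (D' ⊂ C))) × C ⊆ D
  ⊂-minimal-⊆ {P} P? D = go D (⊂-wellFounded D)
    where
    go : ∀ D → Acc _⊂_ D → P D → Σ (Subset n) λ C → (P C × (∀ D' → P D' → ¬ (D' ⊂ C))) × C ⊆ D
    go D (acc rec) pD with anySubset? (λ D' → P? D' ×-dec D' ⊂? D)
    ... | yes (D' , pD' , D'⊂D) =
      let C , minimal , C⊆D' = go D' (rec D'⊂D) pD' in C , minimal , λ x∈C → proj₁ D'⊂D (C⊆D' x∈C)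
    ... | no none = D , (pD , λ D' pD' D'⊂D → none (D' , pD' , D'⊂D)) , λ x∈D → x∈D

module _ (G : Digraph) where
  open Digraph G

  enters? : (X : Subset n) → Decidable (λ e → head e ∈ X × ¬ (tail e ∈ X))
  enters? X e = (head e ∈? X) ×-dec ¬? (tail e ∈? X)

  indeg-submodular : ∀ A B → indeg G (A ∩ B) + indeg G (A ∪ B) ≤ indeg G A + indeg G B
  indeg-submodular A B =
    count₂-mono (enters? (A ∩ B)) (enters? (A ∪ B)) (enters? A) (enters? B) pointwise (allFinL m)
    where
    pointwise : ∀ e → bit (does (enters? (A ∩ B) e)) + bit (does (enters? (A ∪ B) e))
                    ≤ bit (does (enters? A e)) + bit (does (enters? B e))
    pointwise e
      rewrite does-∈?-∩ (head e) A B | does-∈?-∩ (tail e) A B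
            | does-∈?-∪ (head e) A B | does-∈?-∪ (tail e) A B
      = enters-∩-∪-submodular (does (head e ∈? A)) (does (head e ∈? B))
                              (does (tail e ∈? A)) (does (tail e ∈? B))

  Walk-enters : ∀ {u v es} (X : Subset n) → Walk G u v es → u ∉ X → v ∈ X →
    Σ (Fin m) λ e → List._∈_ e es × head e ∈ X × tail e ∉ X
  Walk-enters X [] u∉X v∈X = ⊥-elim (u∉X v∈X)
  Walk-enters X (step e refl w) u∉X v∈X with head e ∈? X
  ... | yes head∈X = e , here refl , head∈X , u∉X
  ... | no head∉X =
    let e' , e'∈es , enters = Walk-enters X w head∉X v∈X in e' , there e'∈es , enters

  edgeDisjointPaths⇒≤indeg : ∀ ℓ r t (X : Subset n) → EdgeDisjointPaths G ℓ r t →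
    r ∉ X → t ∈ X → ℓ ≤ indeg G X
  edgeDisjointPaths⇒≤indeg ℓ r t X (ps , paths , disjoint) r∉X t∈X = injective⇒≤ {f = slot} slot-injective
    where
    crossing : ∀ i → Σ (Fin m) λ e → List._∈_ e (ps i) × head e ∈ X × tail e ∉ X
    crossing i = Walk-enters X (proj₁ (paths i)) r∉X t∈X

    crossing∈entering : ∀ i → List._∈_ (proj₁ (crossing i)) (filter (enters? X) (allFinL m))
    crossing∈entering i = ∈-filter⁺ (enters? X) (∈-allFin _) (proj₂ (proj₂ (crossing i)))

    slot : Fin ℓ → Fin (indeg G X)
    slot i = index (crossing∈entering i)

    slot-injective : ∀ {i j} → slot i ≡ slot j → i ≡ j
    slot-injective {i} {j} same-slot = decidable-stable (i ≟ᶠ j) λ i≢j →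
      disjoint i j i≢j (proj₁ (crossing i)) (proj₁ (proj₂ (crossing i)))
        (subst (List._∈ ps j) (sym same-crossing) (proj₁ (proj₂ (crossing j))))
      where
      same-crossing : proj₁ (crossing i) ≡ proj₁ (crossing j)
      same-crossing = trans (lookup-index (crossing∈entering i))
        (trans (cong (lookup (filter (enters? X) (allFinL m))) same-slot)
               (sym (lookup-index (crossing∈entering j))))

  Deficient? : ∀ ℓ r T → Decidable (Deficient G ℓ r T)
  Deficient? ℓ r T U = ¬? (r ∈? U) ×-dec nonempty? (U ∩ T) ×-dec (indeg G U ≟ ℓ)

  Deficient⇒⊇Core : ∀ ℓ r T D → Deficient G ℓ r T D → Σ (Subset n) λ C → Core G ℓ r T C × C ⊆ D
  Deficient⇒⊇Core ℓ r T = ⊂-minimal-⊆ (Deficient? ℓ r T)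

  Deficient-∩ : ∀ ℓ r T → RootedConnected G ℓ r T → ∀ U U' →
    Deficient G ℓ r T U → Deficient G ℓ r T U' → ∀ {t} → t ∈ U ∩ U' ∩ T → Deficient G ℓ r T (U ∩ U')
  Deficient-∩ ℓ r T connected U U' (r∉U , _ , indegU) (r∉U' , _ , indegU') {t} t∈U∩U'∩T =
    r∉U∩U' , (t , x∈p∩q⁺ (t∈U∩U' , t∈T)) , ≤-antisym indeg-∩-≤ (separates r∉U∩U' t∈U∩U')
    where
    t∈U : t ∈ U
    t∈U = proj₁ (x∈p∩q⁻ U _ t∈U∩U'∩T)
    t∈U' : t ∈ U'
    t∈U' = proj₁ (x∈p∩q⁻ U' T (proj₂ (x∈p∩q⁻ U _ t∈U∩U'∩T)))
    t∈T : t ∈ T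
    t∈T = proj₂ (x∈p∩q⁻ U' T (proj₂ (x∈p∩q⁻ U _ t∈U∩U'∩T)))
    t∈U∩U' : t ∈ U ∩ U'
    t∈U∩U' = x∈p∩q⁺ (t∈U , t∈U')
    r∉U∩U' : r ∉ U ∩ U'
    r∉U∩U' r∈ = r∉U (proj₁ (x∈p∩q⁻ U U' r∈))
    r∉U∪U' : r ∉ U ∪ U'
    r∉U∪U' r∈ = [ r∉U , r∉U' ] (x∈p∪q⁻ U U' r∈)
    separates : ∀ {X} → r ∉ X → t ∈ X → ℓ ≤ indeg G X
    separates {X} = edgeDisjointPaths⇒≤indeg ℓ r t X (connected t t∈T)
    indeg-∩-≤ : indeg G (U ∩ U') ≤ ℓ
    indeg-∩-≤ = +-cancelʳ-≤ ℓ _ ℓ (begin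
      indeg G (U ∩ U') + ℓ                  ≤⟨ +-monoʳ-≤ (indeg G (U ∩ U')) (separates r∉U∪U' (x∈p∪q⁺ (inj₁ t∈U))) ⟩
      indeg G (U ∩ U') + indeg G (U ∪ U')   ≤⟨ indeg-submodular U U' ⟩
      indeg G U + indeg G U'                ≡⟨ cong₂ _+_ indegU indegU' ⟩
      ℓ + ℓ                                 ∎)
      where open ≤-Reasoning

lemma4 : (G : Digraph) (ℓ : ℕ) (r : Fin (Digraph.n G)) (T : Subset (Digraph.n G))
    → r ∉ T
    → RootedConnected G ℓ r T
    → (C C' : Subset (Digraph.n G))
    → Core G ℓ r T C → Core G ℓ r T C' → ¬ (C ≡ C')
    → (U U' : Subset (Digraph.n G))
    → InHalo G ℓ r T C U → InHalo G ℓ r T C' U'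
    → Empty (U ∩ U' ∩ T)
lemma4 G ℓ r T _ connected C C' _ _ C≢C' U U' (deficientU , _ , haloU) (deficientU' , _ , haloU') (t , t∈U∩U'∩T)
  with Deficient⇒⊇Core G ℓ r T (U ∩ U')
         (Deficient-∩ G ℓ r T connected U U' deficientU deficientU' t∈U∩U'∩T)
... | C'' , coreC'' , C''⊆U∩U' =
  C≢C' (trans (sym (haloU C'' coreC'' (λ x∈C'' → proj₁ (x∈p∩q⁻ U U' (C''⊆U∩U' x∈C'')))))
              (haloU' C'' coreC'' (λ x∈C'' → proj₂ (x∈p∩q⁻ U U' (C''⊆U∩U' x∈C'')))))
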